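{- Let $D$ be a digraph and $X\subseteq V(D)$. If the cycle porosity of $\partial_D(X)$ equals $k$, then there is a set of at most $k^2+2k$ vertices of $D$ that meets every directed cycle of $D$ crossing $\partial_D(X)$.
   Context: Digraphs are finite and simple. $\partial_D(X)$ is the set of edges of $D$ with exactly one endpoint in $X$; a directed cycle crosses $\partial_D(X)$ if it contains an edge of $\partial_D(X)$. The cycle porosity of $\partial_D(X)$ is the maximum, over all families $\mathcal{C}$ of pairwise vertex-disjoint directed cycles of $D$, of the number of edges of $\partial_D(X)$ lying on cycles of $\mathcal{C}$. -}

module Defs where

open import Data.Nat using (ℕ; _≤_; _+_)
open import Data.Fin using (Fin)
open import Data.Bool using (Bool; true; false; _xor_)
open import Data.List using (List; []; _∷_; _++_; [_]; zip; length; filter; map)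
open import Data.Nat.ListAction using (sum)
open import Data.List.Relation.Unary.All using (All)
open import Data.List.Relation.Unary.Any using (Any)
open import Data.List.Relation.Unary.AllPairs using (AllPairs)
open import Data.List.Relation.Unary.Unique.Propositional using (Unique)
open import Data.List.Membership.Propositional using (_∈_; _∉_)
open import Data.Product using (_×_; _,_; Σ; ∃)
open import Relation.Binary.PropositionalEquality using (_≡_; _≢_)
open import Relation.Nullary using (¬_)
open import Data.Bool.Properties using (T?)
open import Function using (_∘_)

-- A finite simple digraph on vertex set Fin n: a Boolean adjacency
-- relation without loops (parallel edges impossible by construction;
-- opposite edges u→v, v→u are allowed, as usual for digraphs).
record Digraph (n : ℕ) : Set where
  field
    adj   : Fin n → Fin n → Bool
    loopless : ∀ v → adj v v ≡ false
open Digraph public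

VSet : ℕ → Set
VSet n = Fin n → Bool

cycEdges : ∀ {n} → List (Fin n) → List (Fin n × Fin n)
cycEdges []       = []
cycEdges (v ∷ vs) = zip (v ∷ vs) (vs ++ [ v ])

record DCycle {n} (D : Digraph n) : Set where
  constructor mkCycle
  field
    verts    : List (Fin n)
    long     : 2 ≤ length verts
    distinct : Unique verts
    isCycle  : All (λ e → adj D (Data.Product.proj₁ e) (Data.Product.proj₂ e) ≡ true)
                   (cycEdges verts)
open DCycle public

-- e = (u,v) lies in ∂_D(X): an edge with exactly one endpoint in X.
-- (Edges of a cycle are already edges of D.)
inBoundary : ∀ {n} → VSet n → Fin n × Fin n → Bool
inBoundary X (u , v) = X u xor X v

Crosses : ∀ {n} {D : Digraph n} → VSet n → DCycle D → Set
Crosses X C = Any (λ e → inBoundary X e ≡ true) (cycEdges (verts C))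

boundaryCount : ∀ {n} {D : Digraph n} → VSet n → DCycle D → ℕ
boundaryCount X C = length (filter (T? ∘ inBoundary X) (cycEdges (verts C)))

VDisjoint : ∀ {n} {D : Digraph n} → DCycle D → DCycle D → Set
VDisjoint C C' = All (λ v → v ∉ verts C') (verts C)

PackingFamily : ∀ {n} (D : Digraph n) → List (DCycle D) → Set
PackingFamily D = AllPairs VDisjoint

-- Number of edges of ∂_D(X) lying on cycles of the family (the cycles are
-- vertex-disjoint, hence edge-disjoint, so this is a sum).
familyCount : ∀ {n} {D : Digraph n} → VSet n → List (DCycle D) → ℕ
familyCount X F = sum (map (boundaryCount X) F)

CyclePorosity : ∀ {n} (D : Digraph n) → VSet n → ℕ → Set
CyclePorosity D X k =
  (Σ (List (DCycle D)) λ F → PackingFamily D F × familyCount X F ≡ k)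
  × (∀ F → PackingFamily D F → familyCount X F ≤ k)

Meets : ∀ {n} {D : Digraph n} → List (Fin n) → DCycle D → Set
Meets S C = Any (λ v → v ∈ S) (verts C)

-- Give a pair (u , x) weight w u x = 1 if it is an edge of ∂(X) and 0 otherwise, and
-- call it allowed if u ≡ x or u → x is an arc of D.  A permutation σ of V(D) whose pairs
-- (u , σ u) are all allowed is a family of disjoint directed cycles plus fixed points, and
-- its weight Σ w u (σ u) counts the boundary edges on those cycles; so every such weight is
-- at most the porosity k.  Egerváry's duality for this assignment problem gives integer
-- potentials y, z with w u x ≤ y u + z x on every allowed pair and Σ (y + z) ≤ k.  They are
-- found by local search from the identity: longest simple paths in the exchange graph of σ
-- either are such potentials or expose an exchange cycle of positive gain, and rerouting σ
-- along it increases the weight.  Loops are allowed pairs of weight 0, so c = y + z is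
-- nonnegative, and summing the potential inequality around a cycle crossing ∂(X) gives it
-- c-weight at least 1.  Hence the list containing every vertex v exactly c v times meets all
-- crossing cycles, and its length Σ c is at most k ≤ k² + 2k.

module Submission where

open import Defs
open import Data.Nat using (ℕ; _≤_; _+_; _*_)
open import Data.Fin using (Fin)
open import Data.List using (List; length)
open import Data.Product using (Σ; _×_)

import Algebra.Properties.CommutativeMonoid.Sum as CommutativeMonoidSum
open import Data.Bool using (true; false; if_then_else_; _xor_)
import Data.Bool.Properties as Bool
open import Data.Empty using (⊥-elim)
open import Data.Fin using (zero; suc; _≟_; toℕ)
open import Data.Fin.Permutation as Perm using (Permutation′; _⟨$⟩ʳ_; _⟨$⟩ˡ_; _∘ₚ_)
import Data.Fin.Properties as FinP
open import Data.Integer as ℤ using (ℤ; +_; 0ℤ; 1ℤ; ∣_∣)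
  renaming (_+_ to _+ᶻ_; _-_ to _-ᶻ_; _≤_ to _≤ᶻ_; _<_ to _<ᶻ_)
import Data.Integer.Properties as ℤP
open import Data.Integer.Tactic.RingSolver using (solve-∀)
open import Data.List
  using ([]; _∷_; _++_; _∷ʳ_; [_]; map; zip; foldr; filter; replicate; allFin; applyUpTo)
open import Data.List.Extrema ℤP.≤-totalOrder using (max; ⊥≤max; xs≤max; argmax-sel)
import Data.List.Properties as LP
open import Data.List.Membership.Propositional using (_∈_; _∉_)
import Data.List.Membership.Propositional.Properties as ∈P
open import Data.List.Relation.Binary.Subset.Propositional using (_⊆_)
open import Data.List.Relation.Unary.All as All using (All; []; _∷_)
import Data.List.Relation.Unary.All.Properties as AllP
open import Data.List.Relation.Unary.AllPairs using ([]; _∷_)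
open import Data.List.Relation.Unary.Any as Any using (Any; here; there)
open import Data.List.Relation.Unary.Unique.Propositional using (Unique)
import Data.List.Relation.Unary.Unique.Propositional.Properties as UniqueP
open import Data.Nat as ℕ using (zero; suc; z≤n; s≤s; _<_)
open import Data.Nat.GeneralisedArithmetic using (fold; fold-+)
open import Data.Nat.Induction using (<-rec)
import Data.Nat.Properties as ℕP
open import Data.Product using (_,_; proj₁; proj₂; swap; ∃)
open import Data.Sum as Sum using (_⊎_; inj₁; inj₂)
open import Data.Vec.Functional using (updateAt)
open import Data.Vec.Functional.Properties using (updateAt-updates; updateAt-minimal)
open import Function using (_∘_; const)
open import Function.Bundles using (Injection)
open import Function.Definitions using (Injective)
open import Function.Properties.Inverse using (↔⇒↣)
open import Relation.Binary.PropositionalEquality hiding ([_])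
open import Relation.Nullary using (¬_; Dec; yes; no; ¬?)
open import Relation.Nullary.Decidable using (_⊎-dec_; _×-dec_)
open import Relation.Unary using (Decidable)

open CommutativeMonoidSum ℤP.+-0-commutativeMonoid
  using (sum; sum-cong-≗; ∑-distrib-+; sum-permute; sum-replicate-zero)

sumᶻ : List ℤ → ℤ
sumᶻ = foldr _+ᶻ_ 0ℤ

sumᶻ-++ : ∀ xs ys → sumᶻ (xs ++ ys) ≡ sumᶻ xs +ᶻ sumᶻ ys
sumᶻ-++ []       ys = sym (ℤP.+-identityˡ _)
sumᶻ-++ (x ∷ xs) ys = trans (cong (x +ᶻ_) (sumᶻ-++ xs ys)) (sym (ℤP.+-assoc x _ _))

module _ {A : Set} where

  sumᶻ-map-++ : ∀ (f : A → ℤ) xs ys → sumᶻ (map f (xs ++ ys)) ≡ sumᶻ (map f xs) +ᶻ sumᶻ (map f ys)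
  sumᶻ-map-++ f xs ys = trans (cong sumᶻ (LP.map-++ f xs ys)) (sumᶻ-++ (map f xs) (map f ys))

  sumᶻ-map-∷ʳ : ∀ (f : A → ℤ) x xs → sumᶻ (map f (xs ∷ʳ x)) ≡ sumᶻ (map f (x ∷ xs))
  sumᶻ-map-∷ʳ f x xs = trans (sumᶻ-map-++ f xs [ x ]) (rotate (sumᶻ (map f xs)) (f x))
    where
    rotate : ∀ a b → a +ᶻ (b +ᶻ 0ℤ) ≡ b +ᶻ a
    rotate = solve-∀

  sumᶻ-map-+ : ∀ (f g : A → ℤ) xs →
               sumᶻ (map (λ x → f x +ᶻ g x) xs) ≡ sumᶻ (map f xs) +ᶻ sumᶻ (map g xs)
  sumᶻ-map-+ f g []       = refl
  sumᶻ-map-+ f g (x ∷ xs) =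
    trans (cong (f x +ᶻ g x +ᶻ_) (sumᶻ-map-+ f g xs))
          (interchange (f x) (g x) (sumᶻ (map f xs)) (sumᶻ (map g xs)))
    where
    interchange : ∀ a b c d → (a +ᶻ b) +ᶻ (c +ᶻ d) ≡ (a +ᶻ c) +ᶻ (b +ᶻ d)
    interchange = solve-∀

  sumᶻ-map-cong : ∀ {f g : A → ℤ} xs → (∀ {x} → x ∈ xs → f x ≡ g x) →
                  sumᶻ (map f xs) ≡ sumᶻ (map g xs)
  sumᶻ-map-cong []       f≡g = refl
  sumᶻ-map-cong (x ∷ xs) f≡g = cong₂ _+ᶻ_ (f≡g (here refl)) (sumᶻ-map-cong xs (f≡g ∘ there))

  sumᶻ-map-mono-≤ : ∀ {f g : A → ℤ} xs → (∀ {x} → x ∈ xs → f x ≤ᶻ g x) →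
                    sumᶻ (map f xs) ≤ᶻ sumᶻ (map g xs)
  sumᶻ-map-mono-≤ []       f≤g = ℤP.≤-refl
  sumᶻ-map-mono-≤ (x ∷ xs) f≤g = ℤP.+-mono-≤ (f≤g (here refl)) (sumᶻ-map-mono-≤ xs (f≤g ∘ there))

  sumᶻ-map-positive : ∀ (f : A → ℤ) xs → 0ℤ <ᶻ sumᶻ (map f xs) → Any (λ x → 0ℤ <ᶻ f x) xs
  sumᶻ-map-positive f []       (ℤ.+<+ ())
  sumᶻ-map-positive f (x ∷ xs) 0<Σ with 0ℤ ℤP.<? f x
  ... | yes 0<fx = here 0<fx
  ... | no  0≮fx = there (sumᶻ-map-positive f xs (ℤP.<-≤-trans 0<Σ Σ≤rest))
    where
    Σ≤rest : f x +ᶻ sumᶻ (map f xs) ≤ᶻ sumᶻ (map f xs)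
    Σ≤rest = subst (f x +ᶻ sumᶻ (map f xs) ≤ᶻ_) (ℤP.+-identityˡ _)
               (ℤP.+-monoˡ-≤ (sumᶻ (map f xs)) (ℤP.≮⇒≥ 0≮fx))

sum-zero : ∀ {n} (f : Fin n → ℤ) → (∀ u → f u ≡ 0ℤ) → sum f ≡ 0ℤ
sum-zero {n} f f≡0 = trans (sum-cong-≗ f≡0) (sum-replicate-zero n)

sum-extract : ∀ {n} (f : Fin n → ℤ) a → sum f ≡ f a +ᶻ sum (updateAt f a (const 0ℤ))
sum-extract f zero    = cong (f zero +ᶻ_) (sym (ℤP.+-identityˡ _))
sum-extract f (suc a) =
  trans (cong (f zero +ᶻ_) (sum-extract (f ∘ suc) a))
        (left-comm (f zero) (f (suc a)) (sum (updateAt (f ∘ suc) a (const 0ℤ))))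
  where
  left-comm : ∀ x y z → x +ᶻ (y +ᶻ z) ≡ y +ᶻ (x +ᶻ z)
  left-comm = solve-∀

sum-supported : ∀ {n} (f : Fin n → ℤ) {us} → Unique us → (∀ u → u ∉ us → f u ≡ 0ℤ) →
                sum f ≡ sumᶻ (map f us)
sum-supported f {[]}     []           f≡0 = sum-zero f (λ u → f≡0 u λ ())
sum-supported f {a ∷ us} (a∉us ∷ !us) f≡0 = begin
  sum f                    ≡⟨ sum-extract f a ⟩
  f a +ᶻ sum f₀            ≡⟨ cong (f a +ᶻ_) (sum-supported f₀ !us f₀≡0) ⟩
  f a +ᶻ sumᶻ (map f₀ us)  ≡⟨ cong (f a +ᶻ_) (sumᶻ-map-cong us (λ u∈us →
                                updateAt-minimal _ a f (All.lookup a∉us u∈us ∘ sym))) ⟩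
  f a +ᶻ sumᶻ (map f us)   ∎
  where
  open ≡-Reasoning
  f₀ = updateAt f a (const 0ℤ)
  f₀≡0 : ∀ u → u ∉ us → f₀ u ≡ 0ℤ
  f₀≡0 u u∉us with u ≟ a
  ... | yes refl = updateAt-updates a f
  ... | no  u≢a  = trans (updateAt-minimal u a f u≢a)
                         (f≡0 u λ { (here u≡a) → u≢a u≡a ; (there u∈us) → u∉us u∈us })

sum-agreeOutside : ∀ {n} (f g : Fin n → ℤ) {us} → Unique us → (∀ u → u ∉ us → f u ≡ g u) →
                   sum f ≡ sum g +ᶻ sumᶻ (map (λ u → f u -ᶻ g u) us)
sum-agreeOutside f g {us} !us f≡g = begin
  sum f                             ≡⟨ sum-cong-≗ (λ u → split (f u) (g u)) ⟩
  sum (λ u → g u +ᶻ (f u -ᶻ g u))   ≡⟨ ∑-distrib-+ g (λ u → f u -ᶻ g u) ⟩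
  sum g +ᶻ sum (λ u → f u -ᶻ g u)   ≡⟨ cong (sum g +ᶻ_) (sum-supported _ !us diff≡0) ⟩
  sum g +ᶻ sumᶻ (map (λ u → f u -ᶻ g u) us) ∎
  where
  open ≡-Reasoning
  split : ∀ a b → a ≡ b +ᶻ (a -ᶻ b)
  split = solve-∀
  diff≡0 : ∀ u → u ∉ us → f u -ᶻ g u ≡ 0ℤ
  diff≡0 u u∉us = trans (cong (_-ᶻ g u) (f≡g u u∉us)) (ℤP.+-inverseʳ (g u))

module _ {A : Set} where

  Unique-length-≤ : ∀ {xs ys : List A} → Unique xs → xs ⊆ ys → length xs ≤ length ys
  Unique-length-≤ {[]}     _             _     = z≤n
  Unique-length-≤ {x ∷ xs} (x∉xs ∷ !xs) xs⊆ys with ∈P.∈-∃++ (xs⊆ys (here refl))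
  ... | ys₁ , ys₂ , refl = begin
    suc (length xs)           ≤⟨ s≤s (Unique-length-≤ !xs xs⊆ys₁ys₂) ⟩
    suc (length (ys₁ ++ ys₂)) ≡⟨ cong suc (LP.length-++ ys₁) ⟩
    suc (length ys₁ + length ys₂) ≡⟨ ℕP.+-suc (length ys₁) (length ys₂) ⟨
    length ys₁ + length (x ∷ ys₂) ≡⟨ LP.length-++ ys₁ ⟨
    length (ys₁ ++ x ∷ ys₂)   ∎
    where
    open ℕP.≤-Reasoning
    xs⊆ys₁ys₂ : xs ⊆ ys₁ ++ ys₂
    xs⊆ys₁ys₂ {y} y∈xs with ∈P.∈-++⁻ ys₁ (xs⊆ys (there y∈xs))
    ... | inj₁ y∈ys₁         = ∈P.∈-++⁺ˡ y∈ys₁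
    ... | inj₂ (here refl)   = ⊥-elim (All.lookup x∉xs y∈xs refl)
    ... | inj₂ (there y∈ys₂) = ∈P.∈-++⁺ʳ ys₁ y∈ys₂

  Unique-split : ∀ (xs : List A) {u ys} → Unique (xs ++ u ∷ ys) → Unique (u ∷ xs) × Unique (u ∷ ys)
  Unique-split []       !ys           = ([] ∷ []) , !ys
  Unique-split (x ∷ xs) (x∉ ∷ !xs++ys) with Unique-split xs !xs++ys
  ... | (u∉xs ∷ !xs) , !u∷ys =
    ((λ u≡x → All.lookup (AllP.++⁻ʳ xs x∉) (here refl) (sym u≡x)) ∷ u∉xs) ∷ (AllP.++⁻ˡ xs x∉ ∷ !xs)
    , !u∷ys

  Unique-∷ʳ : ∀ (x : A) xs → Unique (x ∷ xs) → Unique (xs ∷ʳ x)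
  Unique-∷ʳ x []       _                             = [] ∷ []
  Unique-∷ʳ x (y ∷ xs) ((x≢y ∷ x∉xs) ∷ (y∉xs ∷ !xs)) =
    AllP.++⁺ y∉xs ((x≢y ∘ sym) ∷ []) ∷ Unique-∷ʳ x xs (x∉xs ∷ !xs)

Unique⇒length≤ : ∀ {n} {xs : List (Fin n)} → Unique xs → length xs ≤ n
Unique⇒length≤ {n} {xs} !xs =
  subst (length xs ≤_) (LP.length-tabulate (λ i → i)) (Unique-length-≤ !xs (λ {x} _ → ∈P.∈-allFin x))

module _ {A : Set} where

  pairs : List A → List (A × A)
  pairs []           = []
  pairs (x ∷ [])     = []
  pairs (x ∷ y ∷ xs) = (x , y) ∷ pairs (y ∷ xs)

  pairs-++ : ∀ x xs u ys → pairs (x ∷ xs ++ u ∷ ys) ≡ pairs (x ∷ xs ∷ʳ u) ++ pairs (u ∷ ys)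
  pairs-++ x []       u ys = refl
  pairs-++ x (y ∷ xs) u ys = cong ((x , y) ∷_) (pairs-++ y xs u ys)

  zip-∷ʳ≡pairs : ∀ (v x : A) xs → zip (x ∷ xs) (xs ∷ʳ v) ≡ pairs (x ∷ xs ∷ʳ v)
  zip-∷ʳ≡pairs v x []       = refl
  zip-∷ʳ≡pairs v x (y ∷ xs) = cong ((x , y) ∷_) (zip-∷ʳ≡pairs v y xs)

module _ {A B : Set} where

  map-proj₁-zip : ∀ (xs : List A) (ys : List B) → length xs ≡ length ys → map proj₁ (zip xs ys) ≡ xs
  map-proj₁-zip []       []       _  = refl
  map-proj₁-zip (x ∷ xs) (y ∷ ys) eq = cong (x ∷_) (map-proj₁-zip xs ys (ℕP.suc-injective eq))

  map-proj₂-zip : ∀ (xs : List A) (ys : List B) → length xs ≡ length ys → map proj₂ (zip xs ys) ≡ ys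
  map-proj₂-zip []       []       _  = refl
  map-proj₂-zip (x ∷ xs) (y ∷ ys) eq = cong (y ∷_) (map-proj₂-zip xs ys (ℕP.suc-injective eq))

module _ {n : ℕ} where

  cycEdges≡pairs : ∀ (v : Fin n) vs → cycEdges (v ∷ vs) ≡ pairs (v ∷ vs ∷ʳ v)
  cycEdges≡pairs v = zip-∷ʳ≡pairs v v

  private
    length-rotate : ∀ (v : Fin n) vs → length (v ∷ vs) ≡ length (vs ∷ʳ v)
    length-rotate v vs = sym (trans (LP.length-++ vs) (ℕP.+-comm (length vs) 1))

  sources-cycEdges : ∀ (vs : List (Fin n)) → map proj₁ (cycEdges vs) ≡ vs
  sources-cycEdges []       = refl
  sources-cycEdges (v ∷ vs) = map-proj₁-zip (v ∷ vs) (vs ∷ʳ v) (length-rotate v vs)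

  targets-cycEdges : ∀ (v : Fin n) vs → map proj₂ (cycEdges (v ∷ vs)) ≡ vs ∷ʳ v
  targets-cycEdges v vs = map-proj₂-zip (v ∷ vs) (vs ∷ʳ v) (length-rotate v vs)

  sumᶻ-cycEdges : ∀ (y z : Fin n → ℤ) vs →
                  sumᶻ (map (λ e → y (proj₁ e) +ᶻ z (proj₂ e)) (cycEdges vs))
                  ≡ sumᶻ (map (λ v → y v +ᶻ z v) vs)
  sumᶻ-cycEdges y z []       = refl
  sumᶻ-cycEdges y z (v ∷ vs) = begin
    sumᶻ (map (λ e → y (proj₁ e) +ᶻ z (proj₂ e)) es)
      ≡⟨ sumᶻ-map-+ (y ∘ proj₁) (z ∘ proj₂) es ⟩
    sumᶻ (map (y ∘ proj₁) es) +ᶻ sumᶻ (map (z ∘ proj₂) es)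
      ≡⟨ cong₂ _+ᶻ_ (cong sumᶻ (trans (LP.map-∘ es) (cong (map y) (sources-cycEdges (v ∷ vs)))))
                    (cong sumᶻ (trans (LP.map-∘ es) (cong (map z) (targets-cycEdges v vs)))) ⟩
    sumᶻ (map y (v ∷ vs)) +ᶻ sumᶻ (map z (vs ∷ʳ v))
      ≡⟨ cong (sumᶻ (map y (v ∷ vs)) +ᶻ_) (sumᶻ-map-∷ʳ z v vs) ⟩
    sumᶻ (map y (v ∷ vs)) +ᶻ sumᶻ (map z (v ∷ vs))
      ≡⟨ sumᶻ-map-+ y z (v ∷ vs) ⟨
    sumᶻ (map (λ v → y v +ᶻ z v) (v ∷ vs)) ∎
    where
    open ≡-Reasoning
    es = cycEdges (v ∷ vs)

replicateEach : ∀ {m} → (Fin m → ℕ) → List (Fin m)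
replicateEach {zero}  c = []
replicateEach {suc m} c = replicate (c zero) zero ++ map suc (replicateEach (c ∘ suc))

length-replicateEach : ∀ {m} (c : Fin m → ℕ) → + length (replicateEach c) ≡ sum (λ v → + c v)
length-replicateEach {zero}  c = refl
length-replicateEach {suc m} c = begin
  + length (replicate (c zero) zero ++ map suc (replicateEach (c ∘ suc)))
    ≡⟨ cong +_ (trans (LP.length-++ (replicate (c zero) zero))
                      (cong₂ _+_ (LP.length-replicate (c zero))
                                 (LP.length-map suc (replicateEach (c ∘ suc))))) ⟩
  + (c zero + length (replicateEach (c ∘ suc)))
    ≡⟨ ℤP.pos-+ (c zero) _ ⟩
  + c zero +ᶻ + length (replicateEach (c ∘ suc))
    ≡⟨ cong (+ c zero +ᶻ_) (length-replicateEach (c ∘ suc)) ⟩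
  + c zero +ᶻ sum (λ v → + c (suc v)) ∎
  where open ≡-Reasoning

∈-replicateEach : ∀ {m} (c : Fin m → ℕ) v → 0 < c v → v ∈ replicateEach c
∈-replicateEach {suc m} c zero    0<c with c zero
... | suc _ = here refl
∈-replicateEach {suc m} c (suc v) 0<c =
  ∈P.∈-++⁺ʳ (replicate (c zero) zero) (∈P.∈-map⁺ suc (∈-replicateEach (c ∘ suc) v 0<c))

∀⊎⇒⊎∀ : ∀ {n} {P : Fin n → Set} {B : Set} → (∀ i → P i ⊎ B) → (∀ i → P i) ⊎ B
∀⊎⇒⊎∀ {zero}  h = inj₁ (λ ())
∀⊎⇒⊎∀ {suc n} h with h zero | ∀⊎⇒⊎∀ (h ∘ suc)
... | inj₂ b  | _        = inj₂ b
... | inj₁ _  | inj₂ b   = inj₂ b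
... | inj₁ p₀ | inj₁ pₛ = inj₁ λ { zero → p₀ ; (suc i) → pₛ i }

Least : (ℕ → Set) → ℕ → Set
Least P m = P m × (∀ {j} → j < m → ¬ P j)

least : ∀ {P : ℕ → Set} → Decidable P → ∀ {d} → P d → ∃ (Least P)
least {P} P? {d} = <-rec (λ d → P d → ∃ (Least P)) search d
  where
  search : ∀ d → (∀ {j} → j < d → P j → ∃ (Least P)) → P d → ∃ (Least P)
  search d below Pd with ℕP.anyUpTo? P? d
  ... | yes (j , j<d , Pj) = below j<d Pj
  ... | no  ¬∃            = d , Pd , λ j<d Pj → ¬∃ (_ , j<d , Pj)

-- Orbits of an injective map

module _ {n : ℕ} where

  open import Data.List.Membership.DecPropositional (_≟_ {n}) using (_∈?_)

  fixOn : List (Fin n) → (Fin n → Fin n) → Fin n → Fin n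
  fixOn O f u with u ∈? O
  ... | yes _ = u
  ... | no  _ = f u

  fixOn-∈ : ∀ {O f u} → u ∈ O → fixOn O f u ≡ u
  fixOn-∈ {O} {f} {u} u∈ with u ∈? O
  ... | yes _  = refl
  ... | no  u∉ = ⊥-elim (u∉ u∈)

  fixOn-∉ : ∀ {O f u} → u ∉ O → fixOn O f u ≡ f u
  fixOn-∉ {O} {f} {u} u∉ with u ∈? O
  ... | yes u∈ = ⊥-elim (u∉ u∈)
  ... | no  _  = refl

  fixOn-cases : ∀ O f u → (u ∈ O × fixOn O f u ≡ u) ⊎ (u ∉ O × fixOn O f u ≡ f u)
  fixOn-cases O f u with u ∈? O
  ... | yes u∈ = inj₁ (u∈ , refl)
  ... | no  u∉ = inj₂ (u∉ , refl)

  PreimageClosed : (Fin n → Fin n) → List (Fin n) → Set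
  PreimageClosed f O = ∀ {a} → a ∈ O → ∃ λ c → c ∈ O × a ≡ f c

  preimage-∈ : ∀ {f O} → Injective _≡_ _≡_ f → PreimageClosed f O → ∀ {a b} → a ∈ O → a ≡ f b → b ∈ O
  preimage-∈ {f} {O} f-inj closed a∈ a≡fb with c , c∈ , a≡fc ← closed a∈ =
    subst (_∈ O) (f-inj (trans (sym a≡fc) a≡fb)) c∈

  fixOn-injective : ∀ {f O} → Injective _≡_ _≡_ f → PreimageClosed f O → Injective _≡_ _≡_ (fixOn O f)
  fixOn-injective {f} {O} f-inj closed {a} {b} eq with a ∈? O | b ∈? O
  ... | yes _  | yes _  = eq
  ... | yes a∈ | no  b∉ = ⊥-elim (b∉ (preimage-∈ f-inj closed a∈ eq))
  ... | no  a∉ | yes b∈ = ⊥-elim (a∉ (preimage-∈ f-inj closed b∈ (sym eq)))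
  ... | no  _  | no  _  = f-inj eq

module _ {A : Set} where

  map-applyUpTo : ∀ (f : A → A) (g : ℕ → A) m → applyUpTo (f ∘ g) m ≡ map f (applyUpTo g m)
  map-applyUpTo f g zero    = refl
  map-applyUpTo f g (suc m) = cong (f (g 0) ∷_) (map-applyUpTo f (g ∘ suc) m)

  zip-map-self : ∀ (f : A → A) xs → zip xs (map f xs) ≡ map (λ x → x , f x) xs
  zip-map-self f []       = refl
  zip-map-self f (x ∷ xs) = cong ((x , f x) ∷_) (zip-map-self f xs)

module Orbits {n : ℕ} (f : Fin n → Fin n) (f-injective : Injective _≡_ _≡_ f) where

  iter : ℕ → Fin n → Fin n
  iter i v = fold v f i

  iter-injective : ∀ i {a b} → iter i a ≡ iter i b → a ≡ b
  iter-injective zero    eq = eq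
  iter-injective (suc i) eq = iter-injective i (f-injective eq)

  iter-repeat : ∀ i e v → iter i v ≡ iter (i + e) v → iter e v ≡ v
  iter-repeat i e v eq = sym (iter-injective i (trans eq (fold-+ v f i)))

  repeat⇒return : ∀ {i j} v → i < j → iter i v ≡ iter j v → ∃ λ d → d < j × iter (suc d) v ≡ v
  repeat⇒return {i} {j} v i<j eq with d , i+1+d≡j ← ℕP.m≤n⇒∃[o]m+o≡n i<j =
    d , ℕP.m+n≤o⇒n≤o i (subst (_≤ j) (sym (ℕP.+-suc i d)) (ℕP.≤-reflexive i+1+d≡j))
      , iter-repeat i (suc d) v
          (trans eq (cong (λ t → iter t v) (trans (sym i+1+d≡j) (sym (ℕP.+-suc i d)))))

  eventually-returns : ∀ v → ∃ λ d → iter (suc d) v ≡ v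
  eventually-returns v
    with i , j , i<j , eq ← FinP.pigeonhole (ℕP.n<1+n n) (λ (i : Fin (suc n)) → iter (toℕ i) v)
    with d , _ , ret ← repeat⇒return v i<j eq = d , ret

  record Orbit (v : Fin n) : Set where
    field
      period  : ℕ
      closes  : iter (suc period) v ≡ v
      minimal : ∀ {j} → j < period → iter (suc j) v ≢ v

    elements : List (Fin n)
    elements = applyUpTo (λ i → iter i v) (suc period)

    ∈-elements : ∀ {u} → u ∈ elements → ∃ λ i → i < suc period × u ≡ iter i v
    ∈-elements = ∈P.∈-applyUpTo⁻ (λ i → iter i v)

    elements-unique : Unique elements
    elements-unique = UniqueP.applyUpTo⁺₁ (λ i → iter i v) (suc period) separated
      where
      separated : ∀ {i j} → i < j → j < suc period → iter i v ≢ iter j v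
      separated i<j (s≤s j≤p) eq with d , d<j , ret ← repeat⇒return v i<j eq =
        minimal (ℕP.<-≤-trans d<j j≤p) ret

    elements-cycEdges : cycEdges elements ≡ map (λ u → u , f u) elements
    elements-cycEdges = begin
      zip elements (rest ∷ʳ v)
        ≡⟨ cong (λ t → zip elements (rest ∷ʳ t)) (sym closes) ⟩
      zip elements (rest ∷ʳ iter (suc period) v)
        ≡⟨ cong (zip elements) (LP.applyUpTo-∷ʳ (λ i → iter (suc i) v) period) ⟩
      zip elements (applyUpTo (f ∘ (λ i → iter i v)) (suc period))
        ≡⟨ cong (zip elements) (map-applyUpTo f (λ i → iter i v) (suc period)) ⟩
      zip elements (map f elements)
        ≡⟨ zip-map-self f elements ⟩
      map (λ u → u , f u) elements ∎
      where
      open ≡-Reasoning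
      rest = applyUpTo (λ i → iter (suc i) v) period

    elements-preimage : PreimageClosed f elements
    elements-preimage u∈ with ∈-elements u∈
    ... | zero  , _       , refl =
      iter period v , ∈P.∈-applyUpTo⁺ (λ i → iter i v) (ℕP.n<1+n period) , sym closes
    ... | suc i , s≤s i<p , refl =
      iter i v , ∈P.∈-applyUpTo⁺ (λ i → iter i v) (ℕP.m≤n⇒m≤1+n i<p) , refl

    elements-moved : f v ≢ v → ∀ {u} → u ∈ elements → f u ≢ u
    elements-moved fv≢v u∈ fu≡u with i , _ , refl ← ∈-elements u∈ =
      fv≢v (iter-repeat i 1 v (trans (sym fu≡u) (cong (λ t → iter t v) (ℕP.+-comm 1 i))))

    elements-long : f v ≢ v → 2 ≤ length elements
    elements-long fv≢v = subst (2 ≤_) (sym (LP.length-applyUpTo (λ i → iter i v) (suc period))) (s≤s 1≤p)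
      where
      1≤p : 1 ≤ period
      1≤p with period in eq
      ... | zero  = ⊥-elim (fv≢v (subst (λ p → iter (suc p) v ≡ v) eq closes))
      ... | suc _ = s≤s z≤n

  orbit : ∀ v → Orbit v
  orbit v with d , ret ← eventually-returns v
              with m , ret , min ← least (λ d → iter (suc d) v ≟ v) {d} ret =
    record { period = m ; closes = ret ; minimal = min }

-- Rotation along a cyclic list

module _ {A : Set} where

  ∈-∷ʳ⁺ : ∀ {u : A} x xs → u ∈ x ∷ xs → u ∈ xs ∷ʳ x
  ∈-∷ʳ⁺ x xs (here u≡x)  = ∈P.∈-++⁺ʳ xs (here u≡x)
  ∈-∷ʳ⁺ x xs (there u∈xs) = ∈P.∈-++⁺ˡ u∈xs

  ∈-∷ʳ⁻ : ∀ {u : A} x xs → u ∈ xs ∷ʳ x → u ∈ x ∷ xs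
  ∈-∷ʳ⁻ x xs u∈ with ∈P.∈-++⁻ xs u∈
  ... | inj₁ u∈xs        = there u∈xs
  ... | inj₂ (here u≡x)  = here u≡x

module _ {n : ℕ} where

  open import Data.List.Membership.DecPropositional (_≟_ {n}) using (_∈?_)

  assoc : List (Fin n × Fin n) → Fin n → Fin n
  assoc []            u = u
  assoc ((a , b) ∷ E) u with u ≟ a
  ... | yes _ = b
  ... | no  _ = assoc E u

  assoc-∉ : ∀ E {u} → u ∉ map proj₁ E → assoc E u ≡ u
  assoc-∉ []            u∉ = refl
  assoc-∉ ((a , b) ∷ E) {u} u∉ with u ≟ a
  ... | yes u≡a = ⊥-elim (u∉ (here u≡a))
  ... | no  _   = assoc-∉ E (u∉ ∘ there)

  assoc-∈ : ∀ E {a b} → Unique (map proj₁ E) → (a , b) ∈ E → assoc E a ≡ b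
  assoc-∈ ((a′ , b′) ∷ E) {a} (a′∉ ∷ !E) ab∈ with a ≟ a′ | ab∈
  ... | yes _    | here refl  = refl
  ... | yes refl | there ab∈E = ⊥-elim (All.lookup a′∉ (∈P.∈-map⁺ proj₁ ab∈E) refl)
  ... | no  a≢a′ | here refl  = ⊥-elim (a≢a′ refl)
  ... | no  _    | there ab∈E = assoc-∈ E !E ab∈E

  assoc-∈-keys : ∀ E {u} → u ∈ map proj₁ E → (u , assoc E u) ∈ E
  assoc-∈-keys ((a , b) ∷ E) {u} u∈ with u ≟ a | u∈
  ... | yes refl | _          = here refl
  ... | no  u≢a  | here u≡a   = ⊥-elim (u≢a u≡a)
  ... | no  _    | there u∈E = there (assoc-∈-keys E u∈E)

  keys-swap : ∀ (E : List (Fin n × Fin n)) → map proj₁ (map swap E) ≡ map proj₂ E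
  keys-swap E = sym (LP.map-∘ E)

  assoc-swap-assoc : ∀ (E : List (Fin n × Fin n)) → Unique (map proj₂ E) → map proj₂ E ⊆ map proj₁ E →
                     ∀ u → assoc (map swap E) (assoc E u) ≡ u
  assoc-swap-assoc E !vals vals⊆keys u with u ∈? map proj₁ E
  ... | yes u∈keys = assoc-∈ (map swap E) (subst Unique (sym (keys-swap E)) !vals)
                             (∈P.∈-map⁺ swap (assoc-∈-keys E u∈keys))
  ... | no  u∉keys = trans (cong (assoc (map swap E)) (assoc-∉ E u∉keys))
                           (assoc-∉ (map swap E) (u∉keys ∘ vals⊆keys ∘ subst (u ∈_) (keys-swap E)))

  assoc-permutation : ∀ (E : List (Fin n × Fin n)) → Unique (map proj₁ E) → Unique (map proj₂ E) →
                      map proj₁ E ⊆ map proj₂ E → map proj₂ E ⊆ map proj₁ E → Permutation′ n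
  assoc-permutation E !keys !vals keys⊆vals vals⊆keys =
    Perm.permutation (assoc E) (assoc (map swap E))
      (λ u → subst (λ E′ → assoc E′ (assoc (map swap E) u) ≡ u) swap-swap
               (assoc-swap-assoc (map swap E) (subst Unique (sym swapped-vals) !keys)
                  (subst (_⊆ map proj₁ (map swap E)) (sym swapped-vals)
                     (subst (map proj₁ E ⊆_) (sym (keys-swap E)) keys⊆vals)) u))
      (assoc-swap-assoc E !vals vals⊆keys)
    where
    swap-swap : map swap (map swap E) ≡ E
    swap-swap = trans (sym (LP.map-∘ E)) (LP.map-id E)
    swapped-vals : map proj₂ (map swap E) ≡ map proj₁ E
    swapped-vals = sym (LP.map-∘ E)

  rotation : (vs : List (Fin n)) → Unique vs → Permutation′ n
  rotation []       _   = Perm.id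
  rotation (v ∷ vs) !vs = assoc-permutation (cycEdges (v ∷ vs))
    (subst Unique (sym sources) !vs)
    (subst Unique (sym targets) (Unique-∷ʳ v vs !vs))
    (λ u∈ → subst (_ ∈_) (sym targets) (∈-∷ʳ⁺ v vs (subst (_ ∈_) sources u∈)))
    (λ u∈ → subst (_ ∈_) (sym sources) (∈-∷ʳ⁻ v vs (subst (_ ∈_) targets u∈)))
    where
    sources = sources-cycEdges (v ∷ vs)
    targets = targets-cycEdges v vs

  rotation-∈ : ∀ vs (!vs : Unique vs) {u u′} → (u , u′) ∈ cycEdges vs → rotation vs !vs ⟨$⟩ʳ u ≡ u′
  rotation-∈ (v ∷ vs) !vs uu′∈ =
    assoc-∈ (cycEdges (v ∷ vs)) (subst Unique (sym (sources-cycEdges (v ∷ vs))) !vs) uu′∈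

  rotation-edge : ∀ vs (!vs : Unique vs) {u} → u ∈ vs → (u , rotation vs !vs ⟨$⟩ʳ u) ∈ cycEdges vs
  rotation-edge (v ∷ vs) !vs u∈ =
    assoc-∈-keys (cycEdges (v ∷ vs)) (subst (_ ∈_) (sym (sources-cycEdges (v ∷ vs))) u∈)

  rotation-∉ : ∀ vs (!vs : Unique vs) {u} → u ∉ vs → rotation vs !vs ⟨$⟩ʳ u ≡ u
  rotation-∉ []       _   _   = refl
  rotation-∉ (v ∷ vs) !vs u∉ = assoc-∉ (cycEdges (v ∷ vs)) (u∉ ∘ subst (_ ∈_) (sources-cycEdges (v ∷ vs)))

-- Assignments of the digraph

module Assignment {n : ℕ} (D : Digraph n) (X : VSet n) where

  w : Fin n → Fin n → ℤ
  w u x = if X u xor X x then 1ℤ else 0ℤ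

  wᵉ : Fin n × Fin n → ℤ
  wᵉ e = w (proj₁ e) (proj₂ e)

  w-loop : ∀ u → w u u ≡ 0ℤ
  w-loop u rewrite Bool.xor-same (X u) = refl

  Allowed : Fin n → Fin n → Set
  Allowed u x = u ≡ x ⊎ adj D u x ≡ true

  length-filterBoundary≡sumᶻ : ∀ es → + length (filter (Bool.T? ∘ inBoundary X) es) ≡ sumᶻ (map wᵉ es)
  length-filterBoundary≡sumᶻ []             = refl
  length-filterBoundary≡sumᶻ ((u , x) ∷ es) with X u xor X x
  ... | true  = trans (ℤP.pos-+ 1 _) (cong (1ℤ +ᶻ_) (length-filterBoundary≡sumᶻ es))
  ... | false = trans (length-filterBoundary≡sumᶻ es) (sym (ℤP.+-identityˡ _))

  length-filterBoundary-positive : ∀ es → Any (λ e → inBoundary X e ≡ true) es →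
                                   0 < length (filter (Bool.T? ∘ inBoundary X) es)
  length-filterBoundary-positive ((u , x) ∷ es) (here crossing) rewrite crossing = s≤s z≤n
  length-filterBoundary-positive ((u , x) ∷ es) (there crosses) with inBoundary X (u , x)
  ... | true  = s≤s z≤n
  ... | false = length-filterBoundary-positive es crosses

  Dominates : (Fin n → ℤ) → (Fin n → ℤ) → Set
  Dominates y z = ∀ u x → Allowed u x → w u x ≤ᶻ y u +ᶻ z x

  hittingSet : ∀ y z → Dominates y z →
               Σ (List (Fin n)) λ S → + length S ≡ sum (λ v → y v +ᶻ z v)
                                     × (∀ (C : DCycle D) → Crosses X C → Meets S C)
  hittingSet y z dom = S , |S| , meets
    where
    c : Fin n → ℤ
    c v = y v +ᶻ z v
    0≤c : ∀ v → 0ℤ ≤ᶻ c v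
    0≤c v = subst (_≤ᶻ c v) (w-loop v) (dom v v (inj₁ refl))
    S = replicateEach (∣_∣ ∘ c)
    |S| : + length S ≡ sum c
    |S| = trans (length-replicateEach (∣_∣ ∘ c)) (sum-cong-≗ (λ v → ℤP.0≤i⇒+∣i∣≡i (0≤c v)))
    0<∣c∣ : ∀ {v} → 0ℤ <ᶻ c v → 0 < ∣ c v ∣
    0<∣c∣ {v} 0<c = ℤP.drop‿+<+ (subst (0ℤ <ᶻ_) (sym (ℤP.0≤i⇒+∣i∣≡i (0≤c v))) 0<c)
    load : ∀ (C : DCycle D) → + boundaryCount X C ≤ᶻ sumᶻ (map c (verts C))
    load C = begin
      + boundaryCount X C                               ≡⟨ length-filterBoundary≡sumᶻ es ⟩
      sumᶻ (map wᵉ es)                                  ≤⟨ sumᶻ-map-mono-≤ es dominated ⟩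
      sumᶻ (map (λ e → y (proj₁ e) +ᶻ z (proj₂ e)) es)  ≡⟨ sumᶻ-cycEdges y z (verts C) ⟩
      sumᶻ (map c (verts C))                            ∎
      where
      open ℤP.≤-Reasoning
      es = cycEdges (verts C)
      dominated : ∀ {e} → e ∈ es → wᵉ e ≤ᶻ y (proj₁ e) +ᶻ z (proj₂ e)
      dominated {e} e∈ = dom (proj₁ e) (proj₂ e) (inj₂ (All.lookup (isCycle C) e∈))
    meets : ∀ (C : DCycle D) → Crosses X C → Meets S C
    meets C crosses =
      Any.map (λ {v} 0<c → ∈-replicateEach (∣_∣ ∘ c) v (0<∣c∣ 0<c))
        (sumᶻ-map-positive c (verts C)
          (ℤP.<-≤-trans (ℤ.+<+ (length-filterBoundary-positive (cycEdges (verts C)) crosses)) (load C)))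

  AllowedMap : (Fin n → Fin n) → Set
  AllowedMap f = ∀ u → Allowed u (f u)

  weight : (Fin n → Fin n) → ℤ
  weight f = sum (λ u → w u (f u))

  Moved : (Fin n → Fin n) → DCycle D → Set
  Moved f C = All (λ x → f x ≢ x) (verts C)

  Packing : (Fin n → Fin n) → Set
  Packing f = Σ (List (DCycle D)) λ F → PackingFamily D F × All (Moved f) F × + familyCount X F ≡ weight f

  module SplitOffOrbit (f : Fin n → Fin n) (f-inj : Injective _≡_ _≡_ f) (f-allowed : AllowedMap f)
                    (v : Fin n) (fv≢v : f v ≢ v) where

    open Orbits f f-inj
    open Orbit (orbit v)

    cycle : DCycle D
    cycle = mkCycle elements (elements-long fv≢v) elements-unique
              (subst (All (λ e → adj D (proj₁ e) (proj₂ e) ≡ true)) (sym elements-cycEdges)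
                 (AllP.map⁺ (All.tabulate arc)))
      where
      arc : ∀ {u} → u ∈ elements → adj D u (f u) ≡ true
      arc {u} u∈ with f-allowed u
      ... | inj₁ u≡fu = ⊥-elim (elements-moved fv≢v u∈ (sym u≡fu))
      ... | inj₂ u→fu = u→fu

    boundaryCount-cycle : + boundaryCount X cycle ≡ sumᶻ (map (λ u → w u (f u)) elements)
    boundaryCount-cycle = trans (length-filterBoundary≡sumᶻ (cycEdges elements))
                                (trans (cong (sumᶻ ∘ map wᵉ) elements-cycEdges)
                                       (cong sumᶻ (sym (LP.map-∘ {g = wᵉ} {f = λ u → u , f u} elements))))

    rest : Fin n → Fin n
    rest = fixOn elements f

    rest-injective : Injective _≡_ _≡_ rest
    rest-injective = fixOn-injective f-inj elements-preimage

    rest-allowed : AllowedMap rest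
    rest-allowed u with fixOn-cases elements f u
    ... | inj₁ (_ , ru≡u)  = inj₁ (sym ru≡u)
    ... | inj₂ (_ , ru≡fu) = subst (Allowed u) (sym ru≡fu) (f-allowed u)

    rest-moved : ∀ {u} → rest u ≢ u → f u ≢ u × u ∉ elements
    rest-moved {u} ru≢u with fixOn-cases elements f u
    ... | inj₁ (_ , ru≡u)    = ⊥-elim (ru≢u ru≡u)
    ... | inj₂ (u∉ , ru≡fu) = subst (_≢ u) ru≡fu ru≢u , u∉

    rest-moved⊆ : ∀ todo → (∀ u → f u ≢ u → u ∈ v ∷ todo) → ∀ u → rest u ≢ u → u ∈ todo
    rest-moved⊆ todo moved⊆ u ru≢u with fu≢u , u∉ ← rest-moved ru≢u with moved⊆ u fu≢u
    ... | here refl = ⊥-elim (u∉ (here refl))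
    ... | there u∈ = u∈

    weight-split : weight f ≡ weight rest +ᶻ + boundaryCount X cycle
    weight-split = begin
      weight f
        ≡⟨ sum-agreeOutside _ _ elements-unique (λ u u∉ → cong (w u) (sym (fixOn-∉ u∉))) ⟩
      weight rest +ᶻ sumᶻ (map (λ u → w u (f u) -ᶻ w u (rest u)) elements)
        ≡⟨ cong (weight rest +ᶻ_) (sumᶻ-map-cong elements on-cycle) ⟩
      weight rest +ᶻ sumᶻ (map (λ u → w u (f u)) elements)
        ≡⟨ cong (weight rest +ᶻ_) boundaryCount-cycle ⟨
      weight rest +ᶻ + boundaryCount X cycle ∎
      where
      open ≡-Reasoning
      on-cycle : ∀ {u} → u ∈ elements → w u (f u) -ᶻ w u (rest u) ≡ w u (f u)
      on-cycle {u} u∈ = trans (cong (λ x → w u (f u) -ᶻ w u x) (fixOn-∈ u∈))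
                              (trans (cong (w u (f u) -ᶻ_) (w-loop u)) (ℤP.+-identityʳ _))

    extend : Packing rest → Packing f
    extend (F , packed , moved , count) =
      cycle ∷ F
      , All.map (λ {C} → disjoint {C}) moved ∷ packed
      , All.tabulate (elements-moved fv≢v) ∷ All.map (All.map (proj₁ ∘ rest-moved)) moved
      , (begin
          + (boundaryCount X cycle + familyCount X F)   ≡⟨ ℤP.pos-+ (boundaryCount X cycle) _ ⟩
          + boundaryCount X cycle +ᶻ + familyCount X F  ≡⟨ cong (+ boundaryCount X cycle +ᶻ_) count ⟩
          + boundaryCount X cycle +ᶻ weight rest        ≡⟨ ℤP.+-comm _ (weight rest) ⟩
          weight rest +ᶻ + boundaryCount X cycle        ≡⟨ weight-split ⟨
          weight f                                      ∎)
      where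
      open ≡-Reasoning
      disjoint : ∀ {C} → Moved rest C → VDisjoint cycle C
      disjoint moved-C = All.tabulate (λ x∈ x∈C → All.lookup moved-C x∈C (fixOn-∈ x∈))

  packingOf : ∀ todo f → Injective _≡_ _≡_ f → AllowedMap f → (∀ u → f u ≢ u → u ∈ todo) → Packing f
  packingOf [] f _ _ moved⊆[] = [] , [] , [] , sym (sum-zero _ fixed)
    where
    fixed : ∀ u → w u (f u) ≡ 0ℤ
    fixed u with f u ≟ u
    ... | yes fu≡u = trans (cong (w u) fu≡u) (w-loop u)
    ... | no  fu≢u with () ← moved⊆[] u fu≢u
  packingOf (v ∷ todo) f f-inj f-allowed moved⊆ with f v ≟ v
  ... | yes fv≡v = packingOf todo f f-inj f-allowed moved⊆todo
    where
    moved⊆todo : ∀ u → f u ≢ u → u ∈ todo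
    moved⊆todo u fu≢u with moved⊆ u fu≢u
    ... | here refl = ⊥-elim (fu≢u fv≡v)
    ... | there u∈  = u∈
  ... | no  fv≢v =
    let module O = SplitOffOrbit f f-inj f-allowed v fv≢v
    in O.extend (packingOf todo O.rest O.rest-injective O.rest-allowed (O.rest-moved⊆ todo moved⊆))

  weight≤porosity : ∀ {k} → CyclePorosity D X k →
                    ∀ f → Injective _≡_ _≡_ f → AllowedMap f → weight f ≤ᶻ + k
  weight≤porosity {k} (_ , maximal) f f-inj f-allowed
    with F , packed , _ , count ← packingOf (allFin n) f f-inj f-allowed (λ u _ → ∈P.∈-allFin u) =
    subst (_≤ᶻ + k) count (ℤ.+≤+ (maximal F packed))

  -- Rerouting u from σ u to σ u′ changes the weight by gain u u′; along a cycle of exchange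
  -- arcs all of its vertices can be rerouted at once.
  module Exchange (σ : Permutation′ n) (σ-allowed : AllowedMap (σ ⟨$⟩ʳ_)) where

    open import Data.List.Membership.DecPropositional (_≟_ {n}) using (_∈?_)

    s : Fin n → Fin n
    s = σ ⟨$⟩ʳ_

    Arc : Fin n → Fin n → Set
    Arc u u′ = Allowed u (s u′)

    Arcᵉ : Fin n × Fin n → Set
    Arcᵉ e = Arc (proj₁ e) (proj₂ e)

    Arc? : ∀ u u′ → Dec (Arc u u′)
    Arc? u u′ = (u ≟ s u′) ⊎-dec (adj D u (s u′) Bool.≟ true)

    gain : Fin n → Fin n → ℤ
    gain u u′ = w u (s u′) -ᶻ w u′ (s u′)

    gain-self : ∀ u → gain u u ≡ 0ℤ
    gain-self u = ℤP.+-inverseʳ (w u (s u))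

    gainᵉ : Fin n × Fin n → ℤ
    gainᵉ e = gain (proj₁ e) (proj₂ e)

    pathGain : List (Fin n) → ℤ
    pathGain vs = sumᶻ (map gainᵉ (pairs vs))

    record PathFrom (avoid : List (Fin n)) (v : Fin n) : Set where
      constructor path
      field
        rest        : List (Fin n)
        rest-unique : Unique rest
        rest-avoids : All (_∉ avoid) rest
        steps       : All Arcᵉ (pairs (v ∷ rest))
    open PathFrom

    candidates : List (Fin n) → Fin n → List (Fin n)
    candidates avoid v = filter (λ x → ¬? (x ∈? avoid) ×-dec Arc? v x) (allFin n)

    longest   : ℕ → List (Fin n) → Fin n → ℤ
    extension : ℕ → List (Fin n) → Fin n → Fin n → ℤ

    longest zero    avoid v = 0ℤ
    longest (suc l) avoid v = max 0ℤ (map (extension l avoid v) (candidates avoid v))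

    extension l avoid v x = gain v x +ᶻ longest l (x ∷ avoid) x

    longest-nonneg : ∀ l avoid v → 0ℤ ≤ᶻ longest l avoid v
    longest-nonneg zero    avoid v = ℤP.≤-refl
    longest-nonneg (suc l) avoid v = ⊥≤max 0ℤ (map (extension l avoid v) (candidates avoid v))

    longest-≥ : ∀ l {avoid v} (P : PathFrom avoid v) → length (rest P) ≤ l →
                pathGain (v ∷ rest P) ≤ᶻ longest l avoid v
    longest-≥ l       {avoid} {v} (path [] _ _ _) _ = longest-nonneg l avoid v
    longest-≥ (suc l) {avoid} {v} (path (x ∷ r) (x∉r ∷ !r) (x∉avoid ∷ r-avoids) (arc ∷ arcs)) (s≤s |r|≤l) =
      ℤP.≤-trans (ℤP.+-monoʳ-≤ (gain v x) (longest-≥ l (path r !r r-avoids′ arcs) |r|≤l))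
                 (All.lookup (xs≤max 0ℤ (map (extension l avoid v) (candidates avoid v)))
                    (∈P.∈-map⁺ (extension l avoid v) (∈P.∈-filter⁺ _ (∈P.∈-allFin x) (x∉avoid , arc))))
      where
      r-avoids′ : All (_∉ x ∷ avoid) r
      r-avoids′ = All.zipWith (λ { (x≢y , y∉avoid) → λ { (here y≡x)  → x≢y (sym y≡x)
                                                        ; (there y∈) → y∉avoid y∈ } })
                              (x∉r , r-avoids)

    longest-attained : ∀ l avoid v → Σ (PathFrom avoid v) λ P → pathGain (v ∷ rest P) ≡ longest l avoid v
    longest-attained zero    avoid v = path [] [] [] [] , refl
    longest-attained (suc l) avoid v
      with argmax-sel (λ t → t) 0ℤ (map (extension l avoid v) (candidates avoid v))
    ... | inj₁ max≡0 = path [] [] [] [] , sym max≡0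
    ... | inj₂ max∈
      with x , x∈ , max≡ ← ∈P.∈-map⁻ _ max∈
      with _ , x∉avoid , arc ← ∈P.∈-filter⁻ _ {xs = allFin n} x∈
      with path r !r r-avoids arcs , value ← longest-attained l (x ∷ avoid) x =
      path (x ∷ r) (All.map (λ y∉ x≡y → y∉ (here (sym x≡y))) r-avoids ∷ !r)
                   (x∉avoid ∷ All.map (_∘ there) r-avoids) (arc ∷ arcs)
      , trans (cong (gain v x +ᶻ_) value) (sym max≡)

    p : Fin n → ℤ
    p u = longest n [ u ] u

    Tight : Fin n → Fin n → Set
    Tight u u′ = gain u u′ +ᶻ p u′ ≤ᶻ p u

    record PositiveCycle : Set where
      field
        vertices : List (Fin n)
        unique   : Unique vertices
        arcs     : All Arcᵉ (cycEdges vertices)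
        positive : 0ℤ <ᶻ sumᶻ (map gainᵉ (cycEdges vertices))

    path-unique : ∀ {v} (P : PathFrom [ v ] v) → Unique (v ∷ rest P)
    path-unique (path r !r r-avoids _) = All.map (λ y∉ v≡y → y∉ (here (sym v≡y))) r-avoids ∷ !r

    prepend-tight : ∀ {u u′} → Arc u u′ → (P : PathFrom [ u′ ] u′) → u ∉ u′ ∷ rest P →
                    gain u u′ +ᶻ pathGain (u′ ∷ rest P) ≤ᶻ p u
    prepend-tight {u} {u′} arc P@(path r _ _ arcs) u∉ =
      longest-≥ n (path (u′ ∷ r) (path-unique P) u′∷r-avoids (arc ∷ arcs))
        (ℕP.≤-trans (ℕP.n≤1+n _)
          (Unique⇒length≤ (All.tabulate (λ y∈ u≡y → u∉ (subst (_∈ u′ ∷ r) (sym u≡y) y∈)) ∷ path-unique P)))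
      where
      u′∷r-avoids : All (_∉ [ u ]) (u′ ∷ r)
      u′∷r-avoids = All.tabulate λ y∈ → λ { (here refl) → u∉ y∈ }

    close-or-tight : ∀ {u u′} Q₁ Q₂ → Arc u u′ → Unique (u′ ∷ Q₁ ++ u ∷ Q₂) →
                     All Arcᵉ (pairs (u′ ∷ Q₁ ++ u ∷ Q₂)) →
                     gain u u′ +ᶻ pathGain (u′ ∷ Q₁ ++ u ∷ Q₂) ≤ᶻ p u ⊎ PositiveCycle
    close-or-tight {u} {u′} Q₁ Q₂ arc !Q arcs = decide (cyc ℤP.≤? 0ℤ)
      where
      cyc : ℤ
      cyc = gain u u′ +ᶻ pathGain (u′ ∷ Q₁ ∷ʳ u)
      arcs-split = AllP.++⁻ (pairs (u′ ∷ Q₁ ∷ʳ u)) (subst (All Arcᵉ) (pairs-++ u′ Q₁ u Q₂) arcs)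
      split : gain u u′ +ᶻ pathGain (u′ ∷ Q₁ ++ u ∷ Q₂) ≡ cyc +ᶻ pathGain (u ∷ Q₂)
      split = trans (cong (gain u u′ +ᶻ_)
                      (trans (cong (sumᶻ ∘ map gainᵉ) (pairs-++ u′ Q₁ u Q₂))
                             (sumᶻ-map-++ gainᵉ (pairs (u′ ∷ Q₁ ∷ʳ u)) (pairs (u ∷ Q₂)))))
                    (sym (ℤP.+-assoc (gain u u′) _ _))
      tail≤ : pathGain (u ∷ Q₂) ≤ᶻ p u
      tail≤ with u∉Q₂ ∷ !Q₂ ← proj₂ (Unique-split (u′ ∷ Q₁) !Q) =
        longest-≥ n (path Q₂ !Q₂ (All.map (λ u≢y → λ { (here y≡u) → u≢y (sym y≡u) }) u∉Q₂)
                         (proj₂ arcs-split))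
          (ℕP.≤-trans (ℕP.n≤1+n _) (Unique⇒length≤ (u∉Q₂ ∷ !Q₂)))
      decide : Dec (cyc ≤ᶻ 0ℤ) → gain u u′ +ᶻ pathGain (u′ ∷ Q₁ ++ u ∷ Q₂) ≤ᶻ p u ⊎ PositiveCycle
      decide (yes cyc≤0) = inj₁ (begin
        gain u u′ +ᶻ pathGain (u′ ∷ Q₁ ++ u ∷ Q₂)                      ≡⟨ split ⟩
        cyc +ᶻ pathGain (u ∷ Q₂)                                       ≤⟨ ℤP.+-mono-≤ cyc≤0 tail≤ ⟩
        0ℤ +ᶻ p u                                                      ≡⟨ ℤP.+-identityˡ (p u) ⟩
        p u                                                            ∎)
        where open ℤP.≤-Reasoning
      decide (no cyc≰0) = inj₂ record
        { vertices = u ∷ u′ ∷ Q₁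
        ; unique   = proj₁ (Unique-split (u′ ∷ Q₁) !Q)
        ; arcs     = subst (All Arcᵉ) (sym closing) (arc ∷ proj₁ arcs-split)
        ; positive = subst (λ es → 0ℤ <ᶻ sumᶻ (map gainᵉ es)) (sym closing) (ℤP.≰⇒> cyc≰0)
        }
        where closing = cycEdges≡pairs u (u′ ∷ Q₁)

    -- Prepend the arc u → u′ to a longest path from u′.  If that path avoids u we get a path
    -- from u; otherwise its part up to u closes a cycle through the arc, which either has
    -- positive gain or can be cut out without decreasing the gain.
    arc-tight-or-cycle : ∀ {u u′} → Arc u u′ → Tight u u′ ⊎ PositiveCycle
    arc-tight-or-cycle {u} {u′} arc with longest-attained n [ u′ ] u′
    ... | P@(path r _ _ arcs) , value with u ∈? u′ ∷ r
    ...   | no  u∉ = inj₁ (subst (λ t → gain u u′ +ᶻ t ≤ᶻ p u) value (prepend-tight arc P u∉))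
    ...   | yes u∈ with ∈P.∈-∃++ u∈
    ...     | [] , _ , refl =
      inj₁ (ℤP.≤-reflexive (trans (cong (_+ᶻ p u) (gain-self u)) (ℤP.+-identityˡ (p u))))
    ...     | _ ∷ Q₁ , Q₂ , refl =
      Sum.map₁ (subst (λ t → gain u u′ +ᶻ t ≤ᶻ p u) value) (close-or-tight Q₁ Q₂ arc (path-unique P) arcs)

    tight-or-cycle : (∀ u u′ → Arc u u′ → Tight u u′) ⊎ PositiveCycle
    tight-or-cycle = ∀⊎⇒⊎∀ (λ u → ∀⊎⇒⊎∀ (λ u′ → on-arc u u′))
      where
      on-arc : ∀ u u′ → (Arc u u′ → Tight u u′) ⊎ PositiveCycle
      on-arc u u′ with Arc? u u′
      ... | yes arc = Sum.map₁ (λ tight _ → tight) (arc-tight-or-cycle arc)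
      ... | no ¬arc = inj₁ (λ arc → ⊥-elim (¬arc arc))

    -- The weight of the σ-pair into x, minus p at its source: Σ (p + q) telescopes to weight s.
    q : Fin n → ℤ
    q x = w (σ ⟨$⟩ˡ x) x -ᶻ p (σ ⟨$⟩ˡ x)

    tight⇒dominates : (∀ u u′ → Arc u u′ → Tight u u′) → Dominates p q
    tight⇒dominates tight u x allowed = begin
      w u x                                             ≡⟨ rearrange (w u x) (w u′ x) (p u′) ⟩
      (w u x -ᶻ w u′ x +ᶻ p u′) +ᶻ (w u′ x -ᶻ p u′)     ≤⟨ ℤP.+-monoˡ-≤ (w u′ x -ᶻ p u′) tight-at-x ⟩
      p u +ᶻ q x                                        ∎
      where
      open ℤP.≤-Reasoning
      u′ = σ ⟨$⟩ˡ x
      s[u′]≡x : s u′ ≡ x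
      s[u′]≡x = Perm.inverseʳ σ
      tight-at-x : w u x -ᶻ w u′ x +ᶻ p u′ ≤ᶻ p u
      tight-at-x = subst (λ t → w u t -ᶻ w u′ t +ᶻ p u′ ≤ᶻ p u) s[u′]≡x
                     (tight u u′ (subst (Allowed u) (sym s[u′]≡x) allowed))
      rearrange : ∀ a b c → a ≡ (a -ᶻ b +ᶻ c) +ᶻ (b -ᶻ c)
      rearrange = solve-∀

    sum-p+q : sum (λ v → p v +ᶻ q v) ≡ weight s
    sum-p+q = begin
      sum (λ v → p v +ᶻ q v)                   ≡⟨ ∑-distrib-+ p q ⟩
      sum p +ᶻ sum q                           ≡⟨ cong (sum p +ᶻ_) (sum-permute q σ) ⟩
      sum p +ᶻ sum (q ∘ s)                     ≡⟨ cong (sum p +ᶻ_) (sum-cong-≗ q∘s) ⟩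
      sum p +ᶻ sum (λ u → w u (s u) -ᶻ p u)    ≡⟨ ∑-distrib-+ p _ ⟨
      sum (λ u → p u +ᶻ (w u (s u) -ᶻ p u))    ≡⟨ sum-cong-≗ (λ u → cancel (p u) (w u (s u))) ⟩
      weight s                                 ∎
      where
      open ≡-Reasoning
      q∘s : ∀ u → q (s u) ≡ w u (s u) -ᶻ p u
      q∘s u = cong (λ t → w t (s u) -ᶻ p t) (Perm.inverseˡ σ)
      cancel : ∀ a b → a +ᶻ (b -ᶻ a) ≡ b
      cancel = solve-∀

    improve : PositiveCycle →
              Σ (Permutation′ n) λ σ′ → AllowedMap (σ′ ⟨$⟩ʳ_) × weight s <ᶻ weight (σ′ ⟨$⟩ʳ_)
    improve C = ρ ∘ₚ σ , allowed , subst (weight s <ᶻ_) (sym weight-improved) gained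
      where
      open PositiveCycle C
      ρ = rotation vertices unique
      r : Fin n → Fin n
      r = ρ ⟨$⟩ʳ_
      allowed : AllowedMap (s ∘ r)
      allowed u with u ∈? vertices
      ... | yes u∈ = All.lookup arcs (rotation-edge vertices unique u∈)
      ... | no  u∉ = subst (λ t → Allowed u (s t)) (sym (rotation-∉ vertices unique u∉)) (σ-allowed u)
      cycle-gain : sumᶻ (map (λ u → w u (s (r u)) -ᶻ w u (s u)) vertices)
                   ≡ sumᶻ (map gainᵉ (cycEdges vertices))
      cycle-gain = trans (sym (sumᶻ-cycEdges (λ u → w u (s (r u))) (λ u → ℤ.- w u (s u)) vertices))
                         (sumᶻ-map-cong (cycEdges vertices) (λ e∈ →
                            cong (λ t → w _ (s t) -ᶻ w _ _) (rotation-∈ vertices unique e∈)))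
      weight-improved : weight (s ∘ r) ≡ weight s +ᶻ sumᶻ (map gainᵉ (cycEdges vertices))
      weight-improved = trans (sum-agreeOutside _ _ unique
                                 (λ u u∉ → cong (λ t → w u (s t)) (rotation-∉ vertices unique u∉)))
                              (cong (weight s +ᶻ_) cycle-gain)
      gained : weight s <ᶻ weight s +ᶻ sumᶻ (map gainᵉ (cycEdges vertices))
      gained = subst (_<ᶻ weight s +ᶻ sumᶻ (map gainᵉ (cycEdges vertices))) (ℤP.+-identityʳ (weight s))
                     (ℤP.+-monoʳ-< (weight s) positive)

  DualSolution : ℕ → Set
  DualSolution k = Σ (Fin n → ℤ) λ y → Σ (Fin n → ℤ) λ z → Dominates y z × sum (λ v → y v +ᶻ z v) ≤ᶻ + k

  module LocalSearch {k : ℕ} (porosity : CyclePorosity D X k) where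

    weight≤k : ∀ σ → AllowedMap (σ ⟨$⟩ʳ_) → weight (σ ⟨$⟩ʳ_) ≤ᶻ + k
    weight≤k σ allowed = weight≤porosity porosity (σ ⟨$⟩ʳ_) (Injection.injective (↔⇒↣ σ)) allowed

    search : ∀ fuel σ (allowed : AllowedMap (σ ⟨$⟩ʳ_)) → + k ≤ᶻ weight (σ ⟨$⟩ʳ_) +ᶻ + fuel → DualSolution k
    search fuel σ allowed k≤ with Exchange.tight-or-cycle σ allowed
    ... | inj₁ tight = p , q , tight⇒dominates tight , subst (_≤ᶻ + k) (sym sum-p+q) (weight≤k σ allowed)
      where open Exchange σ allowed
    ... | inj₂ cycle with σ′ , allowed′ , better ← Exchange.improve σ allowed cycle | fuel
    ...   | zero     = ⊥-elim (ℤP.<-irrefl refl (begin-strict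
      + k                             ≤⟨ k≤ ⟩
      weight (σ ⟨$⟩ʳ_) +ᶻ 0ℤ          ≡⟨ ℤP.+-identityʳ _ ⟩
      weight (σ ⟨$⟩ʳ_)                <⟨ better ⟩
      weight (σ′ ⟨$⟩ʳ_)               ≤⟨ weight≤k σ′ allowed′ ⟩
      + k                             ∎))
      where open ℤP.≤-Reasoning
    ...   | suc fuel = search fuel σ′ allowed′ (begin
      + k                                  ≤⟨ k≤ ⟩
      weight (σ ⟨$⟩ʳ_) +ᶻ (1ℤ +ᶻ + fuel)   ≡⟨ shift (weight (σ ⟨$⟩ʳ_)) (+ fuel) ⟩
      1ℤ +ᶻ weight (σ ⟨$⟩ʳ_) +ᶻ + fuel     ≤⟨ ℤP.+-monoˡ-≤ (+ fuel) (ℤP.i<j⇒suc[i]≤j better) ⟩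
      weight (σ′ ⟨$⟩ʳ_) +ᶻ + fuel          ∎)
      where
      open ℤP.≤-Reasoning
      shift : ∀ a b → a +ᶻ (1ℤ +ᶻ b) ≡ 1ℤ +ᶻ a +ᶻ b
      shift = solve-∀

  -- Each improvement gains at least 1 and weights never exceed k, so from the identity
  -- (weight 0) fuel k suffices.
  dualSolution : ∀ {k} → CyclePorosity D X k → DualSolution k
  dualSolution {k} porosity = LocalSearch.search porosity k Perm.id (λ u → inj₁ refl) start
    where
    start : + k ≤ᶻ weight (Perm.id ⟨$⟩ʳ_) +ᶻ + k
    start = subst (λ t → + k ≤ᶻ t +ᶻ + k) (sym (sum-zero _ w-loop))
                  (ℤP.≤-reflexive (sym (ℤP.+-identityˡ (+ k))))

k≤k*k+2*k : ∀ k → k ≤ k * k + 2 * k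
k≤k*k+2*k k = ℕP.≤-trans (ℕP.m≤m+n k (k + 0)) (ℕP.m≤n+m (2 * k) (k * k))

corollary2p13 : ∀ {n} (D : Digraph n) (X : VSet n) (k : ℕ) →
    CyclePorosity D X k →
    Σ (List (Fin n)) λ S → (length S ≤ k * k + 2 * k)
    × (∀ (C : DCycle D) → Crosses X C → Meets S C)
corollary2p13 D X k porosity
  with y , z , dominates , total≤k ← Assignment.dualSolution D X porosity
  with S , |S|≡total , meets ← Assignment.hittingSet D X y z dominates =
  S , ℕP.≤-trans |S|≤k (k≤k*k+2*k k) , meets
  where
  |S|≤k : length S ≤ k
  |S|≤k = ℤP.drop‿+≤+ (subst (_≤ᶻ + k) (sym |S|≡total) total≤k)
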